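{- Let $\mathcal{V}$ be an equational class and $\mathbf{A}$ a finitely presented algebra in $\mathcal{V}$. (a) For any onto homomorphism $u\colon\mathbf{A}\to\mathbf{B}$: $u\in\mathsf{C}_{\mathcal{V}}(\mathbf{A})$ iff $\ker(u)\in\mathrm{Con}_e(\mathbf{A})$. (b) For all $u,v\in\mathsf{C}_{\mathcal{V}}(\mathbf{A})$: $u\le v$ iff $\ker(v)\subseteq\ker(u)$. Hence the map $\ker\colon\mathsf{C}_{\mathcal{V}}(\mathbf{A})\to\mathrm{Con}_e(\mathbf{A})$ is an equivalence between the preordered sets $(\mathsf{C}_{\mathcal{V}}(\mathbf{A}),\le)$ and $(\mathrm{Con}_e(\mathbf{A}),\supseteq)$ (i.e., every element of $\mathrm{Con}_e(\mathbf{A})$ is equivalent in the preorder to one of the form $\ker(u)$, and $u\le v$ iff $\ker(u)\supseteq\ker(v)$), and $\mathrm{type}(\mathsf{C}_{\mathcal{V}}(\mathbf{A}))=\mathrm{type}(\mathrm{Con}_e(\mathbf{A}))$.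
   Context: $\mathbf{F}_{\mathcal{V}}(\omega)$ is the free algebra of $\mathcal{V}$ on countably infinitely many generators. An algebra is exact in $\mathcal{V}$ if it is isomorphic to a finitely generated subalgebra of $\mathbf{F}_{\mathcal{V}}(\omega)$. For a finitely presented $\mathbf{A}\in\mathcal{V}$, a coexact unifier of $\mathbf{A}$ is an onto homomorphism $u\colon\mathbf{A}\to\mathbf{E}$ with $\mathbf{E}$ exact in $\mathcal{V}$; $\mathsf{C}_{\mathcal{V}}(\mathbf{A})$ is the set of coexact unifiers preordered by $u\le v$ iff there is a homomorphism $f$ with $f\circ v=u$. $\ker(u)=\{(a,b)\mid u(a)=u(b)\}$. $\mathrm{Con}_e(\mathbf{A})$ is the set of congruences $\theta$ of $\mathbf{A}$ such that $\mathbf{A}/\theta$ is isomorphic to a subalgebra of $\mathbf{F}_{\mathcal{V}}(\omega)$. Types of a preordered set $(P,\le)$: a complete set is $M\subseteq P$ such that every $x\in P$ has $y\in M$ with $x\le y$; a $\mu$-set is a complete set of pairwise incomparable elements; $\mathrm{type}(P)$ is $0$ if no $\mu$-set exists, $\infty$ if there is an infinite $\mu$-set, $\omega$ if there is a finite $\mu$-set of size $>1$, $1$ if there is a $\mu$-set of size $1$. -}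

module Defs where

open import Level using (0ℓ)
open import Data.Nat using (ℕ; _≤_)
open import Data.Fin using (Fin)
open import Data.List using (List)
open import Data.List.Membership.Propositional using (_∈_)
open import Data.Product using (Σ; ∃; _×_; _,_)
open import Relation.Binary using (IsEquivalence)
open import Relation.Binary.PropositionalEquality using (_≡_; _≢_)
open import Relation.Nullary using (¬_)
open import Function.Bundles using (_↔_)

record Signature : Set₁ where
  field
    Op    : Set
    arity : Op → ℕ

module _ (S : Signature) where
  open Signature S

  data Term (X : Set) : Set where
    var  : X → Term X
    node : (f : Op) → (Fin (arity f) → Term X) → Term X

  subst : {X Y : Set} → (X → Term Y) → Term X → Term Y
  subst σ (var x)     = σ x
  subst σ (node f ts) = node f (λ i → subst σ (ts i))

-- An equational class V = Mod(Id) given by a signature and a set of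
-- identities (pairs of terms in countably many variables).
record EqClass : Set₁ where
  field
    sig : Signature
    Id  : Set
    lhs : Id → Term sig ℕ
    rhs : Id → Term sig ℕ
  open Signature sig public

module _ (S : Signature) where
  open Signature S

  record Algebra : Set₁ where
    field
      Carrier  : Set
      _≈_      : Carrier → Carrier → Set
      isEquiv  : IsEquivalence _≈_
      op       : (f : Op) → (Fin (arity f) → Carrier) → Carrier
      op-cong  : ∀ f {xs ys} → (∀ i → xs i ≈ ys i) → op f xs ≈ op f ys

  open Algebra

  record Hom (A B : Algebra) : Set where
    field
      fun      : Carrier A → Carrier B
      fun-cong : ∀ {x y} → _≈_ A x y → _≈_ B (fun x) (fun y)
      preserve : ∀ f xs → _≈_ B (fun (op A f xs)) (op B f (λ i → fun (xs i)))
  open Hom public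

  Onto : {A B : Algebra} → Hom A B → Set
  Onto {A} {B} h = ∀ b → ∃ λ a → _≈_ B (fun h a) b

  record _≅_ (A B : Algebra) : Set where
    field
      to      : Hom A B
      from    : Hom B A
      to-from : ∀ b → _≈_ B (fun to (fun from b)) b
      from-to : ∀ a → _≈_ A (fun from (fun to a)) a

  Rel : Algebra → Set₁
  Rel A = Carrier A → Carrier A → Set

  record IsCongruence (A : Algebra) (θ : Rel A) : Set where
    field
      equiv    : IsEquivalence θ
      ≈⊆θ      : ∀ {x y} → _≈_ A x y → θ x y
      compat   : ∀ f {xs ys} → (∀ i → θ (xs i) (ys i)) → θ (op A f xs) (op A f ys)

  Quot : (A : Algebra) (θ : Rel A) → IsCongruence A θ → Algebra
  Quot A θ c = record
    { Carrier = Carrier A ; _≈_ = θ ; isEquiv = IsCongruence.equiv c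
    ; op = op A ; op-cong = IsCongruence.compat c }

  ker : {A B : Algebra} → Hom A B → Rel A
  ker {A} {B} u a b = _≈_ B (fun u a) (fun u b)

  _⊆_ : {A : Algebra} → Rel A → Rel A → Set
  θ ⊆ ψ = ∀ a b → θ a b → ψ a b

module _ (V : EqClass) where
  open EqClass V

  -- V-derivability over variables X from extra hypotheses R
  -- (the congruence of the term algebra generated by all substitution
  --  instances of identities of V together with the pairs in R)
  data Derive (X : Set) (R : List (Term sig X × Term sig X))
       : Term sig X → Term sig X → Set where
    drefl  : ∀ {t} → Derive X R t t
    dsym   : ∀ {s t} → Derive X R s t → Derive X R t s
    dtrans : ∀ {s t w} → Derive X R s t → Derive X R t w → Derive X R s w
    dcong  : ∀ f {ss ts} → (∀ i → Derive X R (ss i) (ts i))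
             → Derive X R (node f ss) (node f ts)
    daxiom : ∀ (σ : ℕ → Term sig X) e
             → Derive X R (subst sig σ (lhs e)) (subst sig σ (rhs e))
    dhyp   : ∀ {s t} → (s , t) ∈ R → Derive X R s t

  derive-equiv : ∀ {X R} → IsEquivalence (Derive X R)
  derive-equiv = record { refl = drefl ; sym = dsym ; trans = dtrans }

  Presented : (X : Set) → List (Term sig X × Term sig X) → Algebra sig
  Presented X R = record
    { Carrier = Term sig X ; _≈_ = Derive X R ; isEquiv = derive-equiv
    ; op = node ; op-cong = dcong }

  Free-ω : Algebra sig
  Free-ω = Presented ℕ Data.List.[]

  FinPres : Algebra sig → Set
  FinPres A = Σ ℕ λ n → Σ (List (Term sig (Fin n) × Term sig (Fin n))) λ R →
              _≅_ sig A (Presented (Fin n) R)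

  record Subuniverse : Set₁ where
    field
      mem     : Term sig ℕ → Set
      closed  : ∀ f ts → (∀ i → mem (ts i)) → mem (node f ts)
      resp    : ∀ {s t} → Derive ℕ Data.List.[] s t → mem s → mem t

  SubAlg : Subuniverse → Algebra sig
  SubAlg U = record
    { Carrier = Σ (Term sig ℕ) mem
    ; _≈_ = λ x y → Derive ℕ Data.List.[] (Data.Product.proj₁ x) (Data.Product.proj₁ y)
    ; isEquiv = record { refl = drefl ; sym = dsym ; trans = dtrans }
    ; op = λ f xs → node f (λ i → Data.Product.proj₁ (xs i))
                  , closed f _ (λ i → Data.Product.proj₂ (xs i))
    ; op-cong = λ f ps → dcong f ps }
    where open Subuniverse U

  data Sg (gs : List (Term sig ℕ)) : Term sig ℕ → Set where
    gen  : ∀ {t} → t ∈ gs → Sg gs t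
    sop  : ∀ f ts → (∀ i → Sg gs (ts i)) → Sg gs (node f ts)
    sres : ∀ {s t} → Derive ℕ Data.List.[] s t → Sg gs s → Sg gs t

  SgU : List (Term sig ℕ) → Subuniverse
  SgU gs = record { mem = Sg gs ; closed = sop ; resp = sres }

  Exact : Algebra sig → Set
  Exact E = Σ (List (Term sig ℕ)) λ gs → _≅_ sig E (SubAlg (SgU gs))

  IsConE : (A : Algebra sig) → Rel sig A → Set₁
  IsConE A θ = Σ (IsCongruence sig A θ) λ c →
               Σ Subuniverse λ U → _≅_ sig (Quot sig A θ c) (SubAlg U)

  ConE : Algebra sig → Set₁
  ConE A = Σ (Rel sig A) (IsConE A)

  record Coexact (A : Algebra sig) : Set₁ where
    field
      E     : Algebra sig
      u     : Hom sig A E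
      onto  : Onto sig u
      exact : Exact E

  _≤C_ : {A : Algebra sig} → Coexact A → Coexact A → Set
  x ≤C y = Σ (Hom sig (Coexact.E y) (Coexact.E x)) λ f →
           ∀ a → Algebra._≈_ (Coexact.E x)
                   (fun f (fun (Coexact.u y) a)) (fun (Coexact.u x) a)

  kerC : {A : Algebra sig} → Coexact A → Rel sig A
  kerC x = ker sig (Coexact.u x)

  _≤E_ : {A : Algebra sig} → ConE A → ConE A → Set
  _≤E_ {A} (θ , _) (ψ , _) = _⊆_ sig {A} ψ θ

record MuSet (P : Set₁) (_≼_ : P → P → Set) : Set₂ where
  field
    I         : Set₁
    m         : I → P
    complete  : ∀ x → ∃ λ i → x ≼ m i
    antichain : ∀ i j → i ≢ j → ¬ (m i ≼ m j)

data UType : Set where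
  type0 type1 typeω type∞ : UType

HasType : (P : Set₁) → (P → P → Set) → UType → Set₂
HasType P _≼_ type0 = ¬ MuSet P _≼_
HasType P _≼_ type1 = Σ (MuSet P _≼_) λ M → MuSet.I M ↔ Fin 1
HasType P _≼_ typeω = Σ (MuSet P _≼_) λ M → Σ ℕ λ k → 2 ≤ k × (MuSet.I M ↔ Fin k)
HasType P _≼_ type∞ = Σ (MuSet P _≼_) λ M → ¬ (Σ ℕ λ k → MuSet.I M ↔ Fin k)

-- An onto u : A → B gives B ≅ A/ker u, so whether B is exact depends only on ker u; the one
-- point needing finite presentability is that an onto image of A inside F_V(ω) is generated
-- by the images of the finitely many generators of A. A homomorphism factors through an onto
-- u exactly when its kernel contains ker u. So ker and the quotient map are mutually inverse
-- up to equivalence between C_V(A) and (Con_e(A), ⊇), and such an equivalence carries μ-sets,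
-- with their index sets, back and forth.
module Submission where

open import Level using (0ℓ)
open import Defs
open import Data.Product using (Σ; _×_; _,_; proj₁; proj₂)
open import Data.Fin using (Fin)
open import Data.Nat using (ℕ)
open import Data.List using (List; map; allFin)
open import Data.List.Membership.Propositional using (_∈_)
open import Data.List.Membership.Propositional.Properties using (∈-map⁺; ∈-map⁻; ∈-allFin)
open import Relation.Binary using (IsEquivalence; Setoid)
open import Relation.Binary.PropositionalEquality using (refl)
import Relation.Binary.Reasoning.Setoid as SetoidReasoning

module _ {S : Signature} where
  open Algebra
  open Hom

  setoid : Algebra S → Setoid 0ℓ 0ℓ
  setoid X = record { isEquivalence = isEquiv X }

  module ≈ (X : Algebra S) = IsEquivalence (isEquiv X)
  module ≈-Reasoning (X : Algebra S) = SetoidReasoning (setoid X)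

  private
    variable
      A B C : Algebra S

  _∘ʰ_ : Hom S B C → Hom S A B → Hom S A C
  _∘ʰ_ {C = C} g h = record
    { fun      = λ a → fun g (fun h a)
    ; fun-cong = λ p → fun-cong g (fun-cong h p)
    ; preserve = λ f xs → ≈.trans C (fun-cong g (preserve h f xs)) (preserve g f _) }

  ∘ʰ-onto : (g : Hom S B C) (h : Hom S A B) → Onto S g → Onto S h → Onto S (g ∘ʰ h)
  ∘ʰ-onto {C = C} g h g-onto h-onto c =
    let (b , gb≈c) = g-onto c
        (a , ha≈b) = h-onto b
    in a , ≈.trans C (fun-cong g ha≈b) gb≈c

  ≅-sym : _≅_ S A B → _≅_ S B A
  ≅-sym i = record { to = from ; from = to ; to-from = from-to ; from-to = to-from }
    where open _≅_ i

  ≅-trans : _≅_ S A B → _≅_ S B C → _≅_ S A C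
  ≅-trans {A = A} {C = C} i j = record
    { to      = J.to ∘ʰ I.to
    ; from    = I.from ∘ʰ J.from
    ; to-from = λ c → ≈.trans C (fun-cong J.to (I.to-from _)) (J.to-from c)
    ; from-to = λ a → ≈.trans A (fun-cong I.from (J.from-to _)) (I.from-to a) }
    where
    module I = _≅_ i
    module J = _≅_ j

  ≅-to-onto : (i : _≅_ S A B) → Onto S (_≅_.to i)
  ≅-to-onto i b = fun from b , to-from b
    where open _≅_ i

  ker-isCongruence : (u : Hom S A B) → IsCongruence S A (ker S u)
  ker-isCongruence {A = A} {B = B} u = record
    { equiv  = record { refl = ≈.refl B ; sym = ≈.sym B ; trans = ≈.trans B }
    ; ≈⊆θ    = fun-cong u
    ; compat = λ f {xs} {ys} ps → begin
        fun u (op A f xs)           ≈⟨ preserve u f xs ⟩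
        op B f (λ i → fun u (xs i)) ≈⟨ op-cong B f ps ⟩
        op B f (λ i → fun u (ys i)) ≈⟨ preserve u f ys ⟨
        fun u (op A f ys)           ∎ }
    where open ≈-Reasoning B

  quotientHom : {θ : Rel S A} (c : IsCongruence S A θ) → Hom S A (Quot S A θ c)
  quotientHom c = record
    { fun = λ a → a ; fun-cong = IsCongruence.≈⊆θ c
    ; preserve = λ f xs → IsEquivalence.refl (IsCongruence.equiv c) }

  quotientHom-onto : {θ : Rel S A} (c : IsCongruence S A θ) → Onto S (quotientHom c)
  quotientHom-onto c a = a , IsEquivalence.refl (IsCongruence.equiv c)

  module Section (u : Hom S A B) (onto : Onto S u) where
    pre : Carrier B → Carrier A
    pre b = proj₁ (onto b)

    pre-section : ∀ b → _≈_ B (fun u (pre b)) b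
    pre-section b = proj₂ (onto b)

    pre-cong : ∀ {b b′} → _≈_ B b b′ → ker S u (pre b) (pre b′)
    pre-cong {b} {b′} b≈b′ = begin
      fun u (pre b)  ≈⟨ pre-section b ⟩
      b              ≈⟨ b≈b′ ⟩
      b′             ≈⟨ pre-section b′ ⟨
      fun u (pre b′) ∎
      where open ≈-Reasoning B

    pre-op : ∀ f bs → ker S u (pre (op B f bs)) (op A f (λ i → pre (bs i)))
    pre-op f bs = begin
      fun u (pre (op B f bs))            ≈⟨ pre-section _ ⟩
      op B f bs                          ≈⟨ op-cong B f (λ i → pre-section (bs i)) ⟨
      op B f (λ i → fun u (pre (bs i)))  ≈⟨ preserve u f _ ⟨
      fun u (op A f (λ i → pre (bs i)))  ∎
      where open ≈-Reasoning B

  first-isomorphism : (u : Hom S A B) → Onto S u → (c : IsCongruence S A (ker S u)) →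
                      _≅_ S (Quot S A (ker S u) c) B
  first-isomorphism u onto c = record
    { to      = record { fun = fun u ; fun-cong = λ p → p ; preserve = preserve u }
    ; from    = record { fun = pre ; fun-cong = pre-cong ; preserve = pre-op }
    ; to-from = pre-section
    ; from-to = λ a → pre-section (fun u a) }
    where open Section u onto

  factor-through-onto : (u : Hom S A B) → Onto S u → (v : Hom S A C) →
                        _⊆_ S {A} (ker S u) (ker S v) →
                        Σ (Hom S B C) λ h → ∀ a → _≈_ C (fun h (fun u a)) (fun v a)
  factor-through-onto {C = C} u onto v ker-u⊆ker-v = h , λ a → ker-u⊆ker-v _ _ (pre-section (fun u a))
    where
    open Section u onto
    h : Hom S _ C
    h = record
      { fun      = λ b → fun v (pre b)
      ; fun-cong = λ p → ker-u⊆ker-v _ _ (pre-cong p)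
      ; preserve = λ f bs → ≈.trans C (ker-u⊆ker-v _ _ (pre-op f bs)) (preserve v f _) }

  ker-⊆-of-factor : (u : Hom S A B) (v : Hom S A C) (h : Hom S B C) →
                    (∀ a → _≈_ C (fun h (fun u a)) (fun v a)) →
                    _⊆_ S {A} (ker S u) (ker S v)
  ker-⊆-of-factor {C = C} u v h h∘u≈v a b ua≈ub = begin
    fun v a          ≈⟨ h∘u≈v a ⟨
    fun h (fun u a)  ≈⟨ fun-cong h ua≈ub ⟩
    fun h (fun u b)  ≈⟨ h∘u≈v b ⟩
    fun v b          ∎
    where open ≈-Reasoning C

record PreorderEquivalence {P Q : Set₁} (_≼_ : P → P → Set) (_⊑_ : Q → Q → Set) : Set₁ where
  field
    to         : P → Q
    from       : Q → P
    to-mono    : ∀ {x y} → x ≼ y → to x ⊑ to y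
    to-reflect : ∀ {x y} → to x ⊑ to y → x ≼ y
    ⊑-to-from  : ∀ q → q ⊑ to (from q)
    to-from-⊑  : ∀ q → to (from q) ⊑ q
    ⊑-trans    : ∀ {p q r} → p ⊑ q → q ⊑ r → p ⊑ r

module _ {P Q : Set₁} {_≼_ : P → P → Set} {_⊑_ : Q → Q → Set}
         (eqv : PreorderEquivalence _≼_ _⊑_) where
  open PreorderEquivalence eqv

  muSet-to : MuSet P _≼_ → MuSet Q _⊑_
  muSet-to M = record
    { I         = I
    ; m         = λ i → to (m i)
    ; complete  = λ q → let (i , fq≼mi) = complete (from q)
                        in i , ⊑-trans (⊑-to-from q) (to-mono fq≼mi)
    ; antichain = λ i j i≢j tmi⊑tmj → antichain i j i≢j (to-reflect tmi⊑tmj) }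
    where open MuSet M

  muSet-from : MuSet Q _⊑_ → MuSet P _≼_
  muSet-from M = record
    { I         = I
    ; m         = λ i → from (m i)
    ; complete  = λ x → let (i , tx⊑mi) = complete (to x)
                        in i , to-reflect (⊑-trans tx⊑mi (⊑-to-from (m i)))
    ; antichain = λ i j i≢j fmi≼fmj → antichain i j i≢j
        (⊑-trans (⊑-to-from (m i)) (⊑-trans (to-mono fmi≼fmj) (to-from-⊑ (m j)))) }
    where open MuSet M

  hasType-transfer : ∀ t → (HasType P _≼_ t → HasType Q _⊑_ t) × (HasType Q _⊑_ t → HasType P _≼_ t)
  hasType-transfer type0 = (λ ¬M M → ¬M (muSet-from M)) , (λ ¬M M → ¬M (muSet-to M))
  hasType-transfer type1 = (λ (M , r) → muSet-to M , r) , (λ (M , r) → muSet-from M , r)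
  hasType-transfer typeω = (λ (M , r) → muSet-to M , r) , (λ (M , r) → muSet-from M , r)
  hasType-transfer type∞ = (λ (M , r) → muSet-to M , r) , (λ (M , r) → muSet-from M , r)

module _ (V : EqClass) where
  open EqClass V using (sig)
  open Hom

  Sg-least : (U : Subuniverse V) {gs : List (Term sig ℕ)} →
             (∀ {t} → t ∈ gs → Subuniverse.mem U t) →
             ∀ {t} → Sg V gs t → Subuniverse.mem U t
  Sg-least U gs⊆U (gen t∈gs)   = gs⊆U t∈gs
  Sg-least U gs⊆U (sop f ts p) = Subuniverse.closed U f ts (λ i → Sg-least U gs⊆U (p i))
  Sg-least U gs⊆U (sres d p)   = Subuniverse.resp U d (Sg-least U gs⊆U p)

  SubAlg-≅-SgU : (U : Subuniverse V) (gs : List (Term sig ℕ)) →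
                 (∀ {t} → t ∈ gs → Subuniverse.mem U t) →
                 (∀ {t} → Subuniverse.mem U t → Sg V gs t) →
                 _≅_ sig (SubAlg V U) (SubAlg V (SgU V gs))
  SubAlg-≅-SgU U gs gs⊆U U⊆Sg = record
    { to      = record { fun = λ (t , t∈U) → t , U⊆Sg t∈U
                       ; fun-cong = λ d → d ; preserve = λ f xs → drefl }
    ; from    = record { fun = λ (t , t∈Sg) → t , Sg-least U gs⊆U t∈Sg
                       ; fun-cong = λ d → d ; preserve = λ f xs → drefl }
    ; to-from = λ _ → drefl
    ; from-to = λ _ → drefl }

  module PresentedImage {n : ℕ} {R : List (Term sig (Fin n) × Term sig (Fin n))} {U : Subuniverse V}
                        (h : Hom sig (Presented V (Fin n) R) (SubAlg V U)) (onto : Onto sig h) where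
    open Subuniverse U

    image : Term sig (Fin n) → Term sig ℕ
    image s = proj₁ (fun h s)

    generators : List (Term sig ℕ)
    generators = map (λ i → image (var i)) (allFin n)

    generators⊆U : ∀ {t} → t ∈ generators → mem t
    generators⊆U t∈gs with ∈-map⁻ (λ i → image (var i)) t∈gs
    ... | i , _ , refl = proj₂ (fun h (var i))

    image∈Sg : ∀ s → Sg V generators (image s)
    image∈Sg (var i)     = gen (∈-map⁺ (λ i → image (var i)) (∈-allFin i))
    image∈Sg (node f ss) = sres (dsym (preserve h f ss)) (sop f _ (λ i → image∈Sg (ss i)))

    U⊆Sg : ∀ {t} → mem t → Sg V generators t
    U⊆Sg t∈U = let (s , hs≈t) = onto (_ , t∈U) in sres hs≈t (image∈Sg s)

    exact : Exact V (SubAlg V U)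
    exact = generators , SubAlg-≅-SgU U generators generators⊆U U⊆Sg

  finPres-image-exact : {A : Algebra sig} {U : Subuniverse V} → FinPres V A →
                        (h : Hom sig A (SubAlg V U)) → Onto sig h → Exact V (SubAlg V U)
  finPres-image-exact {U = U} (n , R , α) h onto =
    PresentedImage.exact {U = U} (h ∘ʰ α.from) (∘ʰ-onto h α.from onto (≅-to-onto (≅-sym α)))
    where module α = _≅_ α

  module _ {A : Algebra sig} where

    exact⇒ker-isConE : {B : Algebra sig} (u : Hom sig A B) → Onto sig u →
                       Exact V B → IsConE V A (ker sig u)
    exact⇒ker-isConE u onto (gs , B≅Sg) =
      ker-isCongruence u , SgU V gs , ≅-trans (first-isomorphism u onto (ker-isCongruence u)) B≅Sg

    ker-isConE⇒exact : {B : Algebra sig} → FinPres V A → (u : Hom sig A B) → Onto sig u →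
                       IsConE V A (ker sig u) → Exact V B
    ker-isConE⇒exact fp u onto (c , U , ι) =
      let (gs , U≅Sg) = finPres-image-exact {U = U} fp (_≅_.to ι ∘ʰ quotientHom c)
                          (∘ʰ-onto (_≅_.to ι) (quotientHom c) (≅-to-onto ι) (quotientHom-onto c))
      in gs , ≅-trans (≅-sym (first-isomorphism u onto c)) (≅-trans ι U≅Sg)

    ≤C⇒kerC-⊇ : (x y : Coexact V A) → _≤C_ V x y → _⊆_ sig {A} (kerC V y) (kerC V x)
    ≤C⇒kerC-⊇ x y (h , h∘uy≈ux) = ker-⊆-of-factor (Coexact.u y) (Coexact.u x) h h∘uy≈ux

    kerC-⊇⇒≤C : (x y : Coexact V A) → _⊆_ sig {A} (kerC V y) (kerC V x) → _≤C_ V x y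
    kerC-⊇⇒≤C x y = factor-through-onto (Coexact.u y) (Coexact.onto y) (Coexact.u x)

    -- Its kernel is θ itself, definitionally.
    quotientUnifier : FinPres V A → ConE V A → Coexact V A
    quotientUnifier fp (θ , c , quot-sub) = record
      { E     = Quot sig A θ c
      ; u     = quotientHom c
      ; onto  = quotientHom-onto c
      ; exact = ker-isConE⇒exact fp (quotientHom c) (quotientHom-onto c) (c , quot-sub) }

    kerC-equivalence : FinPres V A → PreorderEquivalence (_≤C_ V {A}) (_≤E_ V {A})
    kerC-equivalence fp = record
      { to         = λ x → kerC V x , exact⇒ker-isConE (Coexact.u x) (Coexact.onto x) (Coexact.exact x)
      ; from       = quotientUnifier fp
      ; to-mono    = λ {x} {y} → ≤C⇒kerC-⊇ x y
      ; to-reflect = λ {x} {y} → kerC-⊇⇒≤C x y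
      ; ⊑-to-from  = λ _ _ _ p → p
      ; to-from-⊑  = λ _ _ _ p → p
      ; ⊑-trans    = λ p⊇q q⊇r a b r → p⊇q a b (q⊇r a b r) }

theorem3p7 : (V : EqClass) (A : Algebra (EqClass.sig V)) → FinPres V A →
    ((B : Algebra (EqClass.sig V)) (u : Hom (EqClass.sig V) A B) →
        Onto (EqClass.sig V) u →
        (Exact V B → IsConE V A (ker (EqClass.sig V) u))
        × (IsConE V A (ker (EqClass.sig V) u) → Exact V B))
  × ((x y : Coexact V A) →
        (_≤C_ V x y → _⊆_ (EqClass.sig V) {A} (kerC V y) (kerC V x))
        × (_⊆_ (EqClass.sig V) {A} (kerC V y) (kerC V x) → _≤C_ V x y))
  × ((θ : ConE V A) → Σ (Coexact V A) λ x →
        _⊆_ (EqClass.sig V) {A} (kerC V x) (proj₁ θ)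
        × _⊆_ (EqClass.sig V) {A} (proj₁ θ) (kerC V x))
  × ((t : UType) →
        (HasType (Coexact V A) (_≤C_ V) t → HasType (ConE V A) (_≤E_ V) t)
        × (HasType (ConE V A) (_≤E_ V) t → HasType (Coexact V A) (_≤C_ V) t))
theorem3p7 V A fp =
    (λ B u onto → exact⇒ker-isConE V u onto , ker-isConE⇒exact V fp u onto)
  , (λ x y → ≤C⇒kerC-⊇ V x y , kerC-⊇⇒≤C V x y)
  , (λ θ → quotientUnifier V fp θ , (λ _ _ p → p) , (λ _ _ p → p))
  , hasType-transfer (kerC-equivalence V fp)
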